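{- For all integers $q>2$ and $m\ge 2$, $$\left\lceil \sqrt q\right\rceil \le b(C(mq;1,m)) \le \left\lceil\sqrt q\right\rceil + \left\lfloor \tfrac m2\right\rfloor.$$
   Context: For an integer $n$ and positive integers $s_1<\dots<s_t\le n/2$, the circulant graph $C(n;s_1,\dots,s_t)$ has vertex set $\mathbb Z_n$, with distinct vertices $x,y$ adjacent iff $x-y \equiv \pm s_i \pmod n$ for some $i$. For a finite connected graph $G$, let $N_\ell[x]=\{y: d(x,y)\le \ell\}$. A sequence of vertices $(x_1,\dots,x_k)$ is a burning sequence of $G$ if $N_{k-1}[x_1]\cup N_{k-2}[x_2]\cup\cdots\cup N_0[x_k]=V(G)$; the burning number $b(G)$ is the minimum length of a burning sequence of $G$. -}

module Defs where

open import Data.Nat using (ℕ; zero; suc; _+_; _*_; _∸_; _≤_; _<_; NonZero)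
open import Data.Nat.DivMod using (_%_)
open import Data.Fin using (Fin; toℕ)
open import Data.Vec using (Vec; lookup)
open import Data.List using (List)
open import Data.List.Membership.Propositional using (_∈_)
open import Data.Product using (Σ; ∃; ∃-syntax; _×_; _,_)
open import Data.Sum using (_⊎_)
open import Relation.Binary.PropositionalEquality using (_≡_)
open import Relation.Nullary using (¬_)

-- Adjacency in the circulant graph C(n; S) on vertex set Z_n = Fin n:
-- distinct x, y are adjacent iff x - y ≡ ± s (mod n) for some s ∈ S,
-- i.e. y ≡ x + s or x ≡ y + s (mod n).
CircAdj : (n : ℕ) → .{{_ : NonZero n}} → List ℕ → Fin n → Fin n → Set
CircAdj n S x y =
  ¬ (x ≡ y) × (∃[ s ] (s ∈ S × ((toℕ x + s) % n ≡ toℕ y ⊎ (toℕ y + s) % n ≡ toℕ x)))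

data Walk {V : Set} (Adj : V → V → Set) : V → V → ℕ → Set where
  here : ∀ {x} → Walk Adj x x 0
  step : ∀ {x y z k} → Adj x y → Walk Adj y z k → Walk Adj x z (suc k)

DistLe : {V : Set} → (V → V → Set) → V → V → ℕ → Set
DistLe Adj x y ℓ = ∃[ k ] (k ≤ ℓ × Walk Adj x y k)

-- (x_1, ..., x_k) is a burning sequence: every vertex y lies in N_{k-1-i}[x_{i+1}]
-- for some (0-based) index i.
IsBurningSeq : {V : Set} → (V → V → Set) → (k : ℕ) → Vec V k → Set
IsBurningSeq {V} Adj k xs =
  (y : V) → ∃[ i ] DistLe Adj (lookup xs i) y (k ∸ suc (toℕ i))

IsBurningNumber : {V : Set} → (V → V → Set) → ℕ → Set
IsBurningNumber Adj b =
  (∃[ xs ] IsBurningSeq Adj b xs) × (∀ k xs → IsBurningSeq Adj k xs → b ≤ k)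

-- r = ⌈√q⌉  iff  (r-1)^2 < q ≤ r^2   (for q ≥ 1)
IsCeilSqrt : ℕ → ℕ → Set
IsCeilSqrt q r = ((r ∸ 1) * (r ∸ 1) < q) × (q ≤ r * r)

module Submission where

-- Upper bound: cut ℤ_{mq} into q blocks of m consecutive vertices. Steps ±m move between neighbouring
-- blocks and steps ±1 move inside a block, so the ball of radius ℓ + ⌊m/2⌋ around the middle vertex
-- of block c contains the blocks c - ℓ, …, c + ℓ. Burning the path of blocks 0, …, r² - 1 with balls
-- of radii 0, …, r - 1 (the intervals [r² - (ℓ+1)², r² - ℓ²) partition it) therefore gives a burning
-- sequence of length r + ⌊m/2⌋.
-- Lower bound: the block index ⌊x/m⌋ changes by at most 1 modulo q along every edge, so a ball of
-- radius ℓ meets at most 2ℓ + 1 residues modulo q, and a burning sequence of length k meets at most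
-- 1 + 3 + … + (2k - 1) = k² of them; hence q ≤ k².
-- Burning is decidable on a finite graph, so a least burning sequence length exists.

open import Defs
open import Data.Nat as ℕ using (ℕ; zero; suc; _+_; _*_; _∸_; _⊓_; ∣_-_∣; _≤_; _<_; z≤n; s≤s; s≤s⁻¹;
  NonZero; >-nonZero; >-nonZero⁻¹)
open import Data.Nat.Properties
open import Data.Nat.DivMod using (_/_; _%_; m≡m%n+[m/n]*n; m%n<n; [m+kn]%n≡m%n; m<n⇒m%n≡m; m*n/n≡m;
  m<n*o⇒m/o<n; /-monoˡ-≤; +-distrib-/-∣ʳ; n/n≡1; m/n<m)
open import Data.Nat.Divisibility using (n∣m*n; ∣-refl)
open import Data.Nat.Induction using (<-wellFounded)
open import Data.Nat.Tactic.RingSolver using (solve-∀)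
open import Data.Fin as Fin using (Fin; toℕ; fromℕ<; opposite)
open import Data.Fin.Properties using (toℕ-injective; toℕ<n; toℕ-fromℕ<; any?; all?; injective⇒≤;
  opposite-prop; opposite-involutive)
open import Data.Vec using (Vec; []; _∷_; lookup; tabulate)
open import Data.Vec.Properties using (lookup∘tabulate)
open import Data.List using (List; _∷_; [])
open import Data.List.Membership.Propositional using (_∈_; find; lose)
import Data.List.Relation.Unary.Any as Any
open import Data.Product using (Σ-syntax; ∃; ∃-syntax; _×_; _,_)
open import Data.Sum as Sum using (_⊎_; inj₁; inj₂)
open import Data.Empty using (⊥-elim)
open import Function using (_∘_)
open import Algebra.Properties.CommutativeSemigroup +-commutativeSemigroup using ()
  renaming (xy∙z≈xz∙y to +-right-comm)
open import Induction.WellFounded using (Acc; acc)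
open import Relation.Nullary using (Dec; yes; no; ¬_)
open import Relation.Nullary.Decidable using (map′; _×-dec_; _⊎-dec_; ¬?)
open import Relation.Binary using (Symmetric; Setoid; tri<; tri≈; tri>)
open import Relation.Binary.PropositionalEquality

module _ {V : Set} {Adj : V → V → Set} where

  infixr 5 _++ʷ_

  _++ʷ_ : ∀ {x y z k l} → Walk Adj x y k → Walk Adj y z l → Walk Adj x z (k + l)
  here     ++ʷ w = w
  step a v ++ʷ w = step a (v ++ʷ w)

  reverseʷ : Symmetric Adj → ∀ {x y k} → Walk Adj x y k → Walk Adj y x k
  reverseʷ sym-adj here = here
  reverseʷ sym-adj {k = suc k} (step a w) =
    subst (Walk Adj _ _) (+-comm k 1) (reverseʷ sym-adj w ++ʷ step (sym-adj a) here)

least-witness : {P : ℕ → Set} → (∀ k → Dec (P k)) →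
                ∀ {n} → P n → ∃[ b ] (P b × (∀ {k} → P k → b ≤ k))
least-witness {P} P? {n} = go n (<-wellFounded n)
  where
  go : ∀ n → Acc _<_ n → P n → ∃[ b ] (P b × (∀ {k} → P k → b ≤ k))
  go n (acc smaller) pn with anyUpTo? P? n
  ... | yes (k , k<n , pk) = go k (smaller k<n) pk
  ... | no none = n , pn , λ {k} pk → ≮⇒≥ λ k<n → none (k , k<n , pk)

any?-Vec : ∀ {n} k {P : Vec (Fin n) k → Set} → (∀ xs → Dec (P xs)) → Dec (∃ P)
any?-Vec zero    P? = map′ ([] ,_) (λ { ([] , p) → p }) (P? [])
any?-Vec (suc k) P? = map′ (λ (x , xs , p) → x ∷ xs , p) (λ { (x ∷ xs , p) → x , xs , p })
                           (any? λ x → any?-Vec k λ xs → P? (x ∷ xs))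

module BurningDecidable {n} {Adj : Fin n → Fin n → Set} (adj? : ∀ x y → Dec (Adj x y)) where

  walk? : ∀ k x y → Dec (Walk Adj x y k)
  walk? zero    x y = map′ (λ { refl → here }) (λ { here → refl }) (x Fin.≟ y)
  walk? (suc k) x y = map′ (λ (_ , a , w) → step a w) (λ { (step a w) → _ , a , w })
                           (any? λ z → adj? x z ×-dec walk? k z y)

  distLe? : ∀ x y ℓ → Dec (DistLe Adj x y ℓ)
  distLe? x y ℓ = map′ (λ { (k , s≤s k≤ℓ , w) → k , k≤ℓ , w }) (λ (k , k≤ℓ , w) → k , s≤s k≤ℓ , w)
                       (anyUpTo? (λ k → walk? k x y) (suc ℓ))

  burningSeq? : ∀ k → Dec (∃[ xs ] IsBurningSeq Adj k xs)
  burningSeq? k = any?-Vec k λ xs → all? λ y → any? λ i → distLe? (lookup xs i) y _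

  burningNumber-exists : ∀ {U} → ∃[ xs ] IsBurningSeq Adj U xs →
                         ∃[ b ] (IsBurningNumber Adj b × b ≤ U)
  burningNumber-exists burnable with least-witness burningSeq? burnable
  ... | b , burns , least = b , (burns , λ k xs B → least (xs , B)) , least burnable

CircAdj-sym : ∀ {n} .{{_ : NonZero n}} {S} → Symmetric (CircAdj n S)
CircAdj-sym (x≢y , s , s∈S , e) = x≢y ∘ sym , s , s∈S , Sum.swap e

circAdj? : ∀ n .{{_ : NonZero n}} S x y → Dec (CircAdj n S x y)
circAdj? n S x y = ¬? (x Fin.≟ y) ×-dec map′ find (λ (_ , s∈S , p) → lose s∈S p)
  (Any.any? (λ s → ((toℕ x + s) % n ℕ.≟ toℕ y) ⊎-dec ((toℕ y + s) % n ℕ.≟ toℕ x)) S)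

-- Congruence modulo q and the lower bound

module Congruence (q : ℕ) where

  infix 4 _≋_

  -- a ≡ b (mod q), stated without subtraction so that it makes sense in ℕ.
  _≋_ : ℕ → ℕ → Set
  a ≋ b = ∃[ u ] ∃[ v ] (a + u * q ≡ b + v * q)

  ≋-reflexive : ∀ {a b} → a ≡ b → a ≋ b
  ≋-reflexive refl = 0 , 0 , refl

  ≋-sym : ∀ {a b} → a ≋ b → b ≋ a
  ≋-sym (u , v , e) = v , u , sym e

  ≋-trans : ∀ {a b c} → a ≋ b → b ≋ c → a ≋ c
  ≋-trans {a} {b} {c} (u , v , e) (u' , v' , e') = u + u' , v' + v , (begin
      a + (u + u') * q     ≡⟨ spread a u u' ⟩
      a + u * q + u' * q   ≡⟨ cong (_+ u' * q) e ⟩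
      b + v * q + u' * q   ≡⟨ +-right-comm b (v * q) (u' * q) ⟩
      b + u' * q + v * q   ≡⟨ cong (_+ v * q) e' ⟩
      c + v' * q + v * q   ≡⟨ spread c v' v ⟨
      c + (v' + v) * q     ∎)
    where
    open ≡-Reasoning
    spread : ∀ a u u' → a + (u + u') * q ≡ a + u * q + u' * q
    spread a u u' = trans (cong (a +_) (*-distribʳ-+ q u u')) (sym (+-assoc a (u * q) (u' * q)))

  ≋-setoid : Setoid _ _
  ≋-setoid = record { _≈_ = _≋_ ; isEquivalence = record
    { refl = ≋-reflexive refl ; sym = ≋-sym ; trans = ≋-trans } }

  +-congʳ-≋ : ∀ {a b} c → a ≋ b → a + c ≋ b + c
  +-congʳ-≋ {a} {b} c (u , v , e) =
    u , v , trans (+-right-comm a c (u * q)) (trans (cong (_+ c) e) (+-right-comm b (v * q) c))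

  +-cancelʳ-≋ : ∀ {a b} c → a + c ≋ b + c → a ≋ b
  +-cancelʳ-≋ {a} {b} c (u , v , e) = u , v ,
    +-cancelʳ-≡ c (a + u * q) (b + v * q)
      (trans (+-right-comm a (u * q) c) (trans e (+-right-comm b c (v * q))))

  ≋⇒≡ : .{{_ : NonZero q}} → ∀ {a b} → a < q → b < q → a ≋ b → a ≡ b
  ≋⇒≡ {a} {b} a<q b<q (u , v , e) = begin
      a                ≡⟨ m<n⇒m%n≡m a<q ⟨
      a % q            ≡⟨ [m+kn]%n≡m%n a u q ⟨
      (a + u * q) % q  ≡⟨ cong (_% q) e ⟩
      (b + v * q) % q  ≡⟨ [m+kn]%n≡m%n b v q ⟩
      b % q            ≡⟨ m<n⇒m%n≡m b<q ⟩
      b                ∎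
    where open ≡-Reasoning

  Near : ℕ → ℕ → Set
  Near a b = ∃[ d ] (d ≤ 1 × (a + d ≋ b ⊎ b + d ≋ a))

square+offset<square : ∀ {l k J} → l < k → J ≤ l + l → l * l + J < k * k
square+offset<square {l} {k} {J} l<k J≤2l = begin-strict
    l * l + J             ≤⟨ +-monoʳ-≤ (l * l) J≤2l ⟩
    l * l + (l + l)       <⟨ n<1+n _ ⟩
    suc (l * l + (l + l)) ≡⟨ expand l ⟩
    suc l * suc l         ≤⟨ *-mono-≤ l<k l<k ⟩
    k * k                 ∎
  where
  open ≤-Reasoning
  expand : ∀ l → suc (l * l + (l + l)) ≡ suc l * suc l
  expand = solve-∀

square+offset-injective : ∀ {l l' J J'} → J ≤ l + l → J' ≤ l' + l' →
                          l * l + J ≡ l' * l' + J' → l ≡ l'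
square+offset-injective {l} {l'} {J} {J'} J≤ J'≤ e with <-cmp l l'
... | tri< l<l' _ _ = ⊥-elim (<-irrefl e (<-≤-trans (square+offset<square l<l' J≤) (m≤m+n _ J')))
... | tri≈ _ l≡l' _ = l≡l'
... | tri> _ _ l'<l = ⊥-elim (<-irrefl (sym e) (<-≤-trans (square+offset<square l'<l J'≤) (m≤m+n _ J)))

padded≤double : ∀ {j k ℓ} → j ≤ k + k → k ≤ ℓ → j + (ℓ ∸ k) ≤ ℓ + ℓ
padded≤double {j} {k} {ℓ} j≤2k k≤ℓ = begin
    j + (ℓ ∸ k)      ≤⟨ +-monoˡ-≤ (ℓ ∸ k) j≤2k ⟩
    k + k + (ℓ ∸ k)  ≡⟨ trans (+-assoc k k (ℓ ∸ k)) (cong (k +_) (m+[n∸m]≡n k≤ℓ)) ⟩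
    k + ℓ            ≤⟨ +-monoˡ-≤ ℓ k≤ℓ ⟩
    ℓ + ℓ            ∎
  where open ≤-Reasoning

module CycleLowerBound
  {V : Set} (Adj : V → V → Set) (q : ℕ) {{_ : NonZero q}}
  (label : V → ℕ) (section : Fin q → V) (label∘section : ∀ y → label (section y) ≡ toℕ y)
  where

  open Congruence q
  open import Relation.Binary.Reasoning.Setoid ≋-setoid

  near⇒shift : ∀ {a b} → Near a b → ∃[ e ] (e ≤ 2 × b + 1 ≋ a + e)
  near⇒shift {a} {b} (d , d≤1 , inj₁ ad≋b) = suc d , s≤s d≤1 , (begin
    b + 1      ≈⟨ +-congʳ-≋ 1 ad≋b ⟨
    a + d + 1  ≡⟨ trans (+-assoc a d 1) (cong (a +_) (+-comm d 1)) ⟩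
    a + suc d  ∎)
  near⇒shift {a} {b} (zero , _ , inj₂ b0≋a) = 1 , s≤s z≤n , (begin
    b + 1      ≡⟨ cong (_+ 1) (+-identityʳ b) ⟨
    b + 0 + 1  ≈⟨ +-congʳ-≋ 1 b0≋a ⟩
    a + 1      ∎)
  near⇒shift {a} {b} (suc zero , _ , inj₂ b1≋a) = 0 , z≤n , (begin
    b + 1      ≈⟨ b1≋a ⟩
    a          ≡⟨ +-identityʳ a ⟨
    a + 0      ∎)
  near⇒shift (suc (suc _) , s≤s () , inj₂ _)

  module _ (adj⇒near : ∀ {x z} → Adj x z → Near (label x) (label z)) where

    walk-shift : ∀ {x v k} → Walk Adj x v k → ∃[ j ] (j ≤ k + k × label v + k ≋ label x + j)
    walk-shift here = 0 , z≤n , ≋-reflexive refl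
    walk-shift {x} {v} {suc k} (step {y = z} a w) with walk-shift w | near⇒shift (adj⇒near a)
    ... | j , j≤2k , vz | e , e≤2 , zx = j + e , j+e≤ , (begin
      label v + suc k      ≡⟨ trans (+-suc (label v) k) (+-comm 1 (label v + k)) ⟩
      label v + k + 1      ≈⟨ +-congʳ-≋ 1 vz ⟩
      label z + j + 1      ≡⟨ +-right-comm (label z) j 1 ⟩
      label z + 1 + j      ≈⟨ +-congʳ-≋ j zx ⟩
      label x + e + j      ≡⟨ trans (+-assoc (label x) e j) (cong (label x +_) (+-comm e j)) ⟩
      label x + (j + e)    ∎)
      where
      j+e≤ : j + e ≤ suc k + suc k
      j+e≤ = subst (j + e ≤_) (trans (+-comm (k + k) 2) (cong suc (sym (+-suc k k)))) (+-mono-≤ j≤2k e≤2)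

    distLe-shift : ∀ {x v ℓ} → DistLe Adj x v ℓ → ∃[ J ] (J ≤ ℓ + ℓ × label v + ℓ ≋ label x + J)
    distLe-shift {x} {v} {ℓ} (k , k≤ℓ , w) with walk-shift w
    ... | j , j≤2k , vx = j + (ℓ ∸ k) , padded≤double j≤2k k≤ℓ , (begin
      label v + ℓ                ≡⟨ trans (+-assoc (label v) k (ℓ ∸ k)) (cong (label v +_) (m+[n∸m]≡n k≤ℓ)) ⟨
      label v + k + (ℓ ∸ k)      ≈⟨ +-congʳ-≋ (ℓ ∸ k) vx ⟩
      label x + j + (ℓ ∸ k)      ≡⟨ +-assoc (label x) j (ℓ ∸ k) ⟩
      label x + (j + (ℓ ∸ k))    ∎)

    burningSeq⇒q≤k*k : ∀ k (xs : Vec V k) → IsBurningSeq Adj k xs → q ≤ k * k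
    burningSeq⇒q≤k*k k xs burns = injective⇒≤ {f = code ∘ witness} λ {y} {y'} → code-injective (witness y) (witness y')
      where
      radius : Fin k → ℕ
      radius i = k ∸ suc (toℕ i)

      Witness : Fin q → Set
      Witness y = Σ[ i ∈ Fin k ] Σ[ J ∈ ℕ ]
        (J ≤ radius i + radius i × toℕ y + radius i ≋ label (lookup xs i) + J)

      witness : ∀ y → Witness y
      witness y with burns (section y)
      ... | i , reach with distLe-shift reach
      ...   | J , J≤ , c = i , J , J≤ , subst (λ t → t + radius i ≋ _) (label∘section y) c

      code : ∀ {y} → Witness y → Fin (k * k)
      code (i , J , J≤ , _) = fromℕ< (square+offset<square radius<k J≤)
        where
        radius<k : radius i < k
        radius<k = subst (_< k) (opposite-prop i) (toℕ<n (opposite i))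

      radius-injective : ∀ i i' → radius i ≡ radius i' → i ≡ i'
      radius-injective i i' e = toℕ-injective (suc-injective (∸-cancelˡ-≡ (toℕ<n i) (toℕ<n i') e))

      same-witness : ∀ {y y'} i i' J J' → i ≡ i' → radius i * radius i + J ≡ radius i' * radius i' + J' →
        toℕ y + radius i ≋ label (lookup xs i) + J → toℕ y' + radius i' ≋ label (lookup xs i') + J' → y ≡ y'
      same-witness {y} {y'} i .i J J' refl e c c' with +-cancelˡ-≡ (radius i * radius i) J J' e
      ... | refl = toℕ-injective (≋⇒≡ (toℕ<n y) (toℕ<n y') (+-cancelʳ-≋ (radius i) (≋-trans c (≋-sym c'))))

      code-injective : ∀ {y y'} (w : Witness y) (w' : Witness y') → code w ≡ code w' → y ≡ y'
      code-injective (i , J , J≤ , c) (i' , J' , J'≤ , c') eq =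
        same-witness i i' J J' (radius-injective i i' (square+offset-injective J≤ J'≤ e)) e c c'
        where
        e : radius i * radius i + J ≡ radius i' * radius i' + J'
        e = trans (sym (toℕ-fromℕ< _)) (trans (cong toℕ eq) (toℕ-fromℕ< _))

-- Covering a path by balls of radii 0, 1, …, r - 1

threshold : {P : ℕ → Set} → (∀ k → Dec (P k)) → P 0 →
            ∀ {n} → ¬ P n → ∃[ ℓ ] (ℓ < n × P ℓ × ¬ P (suc ℓ))
threshold P? p0 {zero}  ¬p0 = ⊥-elim (¬p0 p0)
threshold P? p0 {suc n} ¬pn with P? n
... | yes pn = n , ≤-refl , pn , ¬pn
... | no ¬pn-1 with threshold P? p0 ¬pn-1
...   | ℓ , ℓ<n , pℓ , ¬pℓ+1 = ℓ , m≤n⇒m≤1+n ℓ<n , pℓ , ¬pℓ+1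

∣s+ℓ-a∣≤ℓ : ∀ {s a ℓ} → s ≤ a → a ≤ s + ℓ + ℓ → ∣ s + ℓ - a ∣ ≤ ℓ
∣s+ℓ-a∣≤ℓ {s} {a} {ℓ} s≤a a≤s+2ℓ with ≤-total (s + ℓ) a
... | inj₁ s+ℓ≤a = subst (_≤ ℓ) (sym (m≤n⇒∣m-n∣≡n∸m s+ℓ≤a)) (m≤n+o⇒m∸n≤o a (s + ℓ) a≤s+2ℓ)
... | inj₂ a≤s+ℓ = subst (_≤ ℓ) (sym (m≤n⇒∣n-m∣≡n∸m a≤s+ℓ)) (m≤n+o⇒m∸n≤o (s + ℓ) a (+-monoˡ-≤ ℓ s≤a))

-- The midpoint of [r² - (ℓ+1)², r² - ℓ²).
pathCentre : ℕ → ℕ → ℕ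
pathCentre r ℓ = r * r ∸ suc ℓ * suc ℓ + ℓ

path-cover : ∀ {r a} → a < r * r → ∃[ ℓ ] (ℓ < r × ∣ pathCentre r ℓ - a ∣ ≤ ℓ)
path-cover {r} {a} a<r*r with threshold (λ ℓ → a + ℓ * ℓ <? r * r)
  (subst (_< r * r) (sym (+-identityʳ a)) a<r*r)
  (λ a+r*r<r*r → <-irrefl refl (≤-<-trans (m≤n+m (r * r) a) a+r*r<r*r))
... | ℓ , ℓ<r , inside , outside = ℓ , ℓ<r , ∣s+ℓ-a∣≤ℓ s≤a a≤s+2ℓ
  where
  s : ℕ
  s = r * r ∸ suc ℓ * suc ℓ
  s≤a : s ≤ a
  s≤a = m≤n+o⇒m∸n≤o (r * r) (suc ℓ * suc ℓ) (subst (r * r ≤_) (+-comm a _) (≮⇒≥ outside))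
  expand : ∀ s ℓ → s + suc ℓ * suc ℓ ≡ suc (s + ℓ + ℓ + ℓ * ℓ)
  expand = solve-∀
  a≤s+2ℓ : a ≤ s + ℓ + ℓ
  a≤s+2ℓ = +-cancelʳ-≤ (ℓ * ℓ) a (s + ℓ + ℓ) (s≤s⁻¹ (begin
    suc (a + ℓ * ℓ)            ≤⟨ inside ⟩
    r * r                      ≡⟨ m∸n+n≡m (*-mono-≤ ℓ<r ℓ<r) ⟨
    s + suc ℓ * suc ℓ          ≡⟨ expand s ℓ ⟩
    suc (s + ℓ + ℓ + ℓ * ℓ)    ∎))
    where open ≤-Reasoning

∣m⊓o-n∣≤∣m-n∣ : ∀ {m n o} → n ≤ o → ∣ m ⊓ o - n ∣ ≤ ∣ m - n ∣
∣m⊓o-n∣≤∣m-n∣ {m} {n} {o} n≤o with ≤-total m o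
... | inj₁ m≤o = ≤-reflexive (cong ∣_- n ∣ (m≤n⇒m⊓n≡m m≤o))
... | inj₂ o≤m = begin
    ∣ m ⊓ o - n ∣  ≡⟨ cong ∣_- n ∣ (m≥n⇒m⊓n≡n o≤m) ⟩
    ∣ o - n ∣      ≡⟨ m≤n⇒∣n-m∣≡n∸m n≤o ⟩
    o ∸ n          ≤⟨ ∸-monoˡ-≤ n o≤m ⟩
    m ∸ n          ≡⟨ m≤n⇒∣n-m∣≡n∸m (≤-trans n≤o o≤m) ⟨
    ∣ m - n ∣      ∎
  where open ≤-Reasoning

∣m/2-b∣≤m/2 : ∀ {m b} → b < m → ∣ m / 2 - b ∣ ≤ m / 2
∣m/2-b∣≤m/2 {m} {b} b<m with ≤-total b (m / 2)
... | inj₁ b≤h = subst (_≤ m / 2) (sym (m≤n⇒∣n-m∣≡n∸m b≤h)) (m∸n≤m (m / 2) b)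
... | inj₂ h≤b = subst (_≤ m / 2) (sym (m≤n⇒∣m-n∣≡n∸m h≤b)) (m≤n+o⇒m∸n≤o b (m / 2) b≤h+h)
  where
  b≤h+h : b ≤ m / 2 + m / 2
  b≤h+h = s≤s⁻¹ (begin
    suc b                  ≤⟨ b<m ⟩
    m                      ≡⟨ m≡m%n+[m/n]*n m 2 ⟩
    m % 2 + m / 2 * 2      ≤⟨ +-monoˡ-≤ (m / 2 * 2) (s≤s⁻¹ (m%n<n m 2)) ⟩
    suc (m / 2 * 2)        ≡⟨ cong suc (trans (*-comm (m / 2) 2) (cong (m / 2 +_) (+-identityʳ (m / 2)))) ⟩
    suc (m / 2 + m / 2)    ∎)
    where open ≤-Reasoning

ceilSqrt-minimal : ∀ {q r k} → IsCeilSqrt q r → q ≤ k * k → r ≤ k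
ceilSqrt-minimal {q} {r} {k} (below , _) q≤k*k with k <? r
... | no k≮r = ≮⇒≥ k≮r
... | yes k<r = ⊥-elim (<-irrefl refl (<-≤-trans (≤-<-trans k*k≤ below) q≤k*k))
  where
  k≤r∸1 : k ≤ r ∸ 1
  k≤r∸1 = <⇒≤pred k<r
  k*k≤ : k * k ≤ (r ∸ 1) * (r ∸ 1)
  k*k≤ = *-mono-≤ k≤r∸1 k≤r∸1

o+t'*s≡o+t*s+[t'∸t]*s : ∀ o s {t t'} → t ≤ t' → o + t' * s ≡ o + t * s + (t' ∸ t) * s
o+t'*s≡o+t*s+[t'∸t]*s o s {t} {t'} t≤t' = begin
  o + t' * s                 ≡⟨ cong (λ u → o + u * s) (m+[n∸m]≡n t≤t') ⟨
  o + (t + (t' ∸ t)) * s     ≡⟨ cong (o +_) (*-distribʳ-+ s t (t' ∸ t)) ⟩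
  o + (t * s + (t' ∸ t) * s) ≡⟨ +-assoc o (t * s) ((t' ∸ t) * s) ⟨
  o + t * s + (t' ∸ t) * s   ∎
  where open ≡-Reasoning

-- The circulant graph C(mq; 1, m)

module CirculantBlocks (m q : ℕ) {{_ : NonZero m}} {{_ : NonZero q}} {{_ : NonZero (m * q)}} where

  open Congruence q

  S : List ℕ
  S = 1 ∷ m ∷ []

  Adj : Fin (m * q) → Fin (m * q) → Set
  Adj = CircAdj (m * q) S

  1∈S : 1 ∈ S
  1∈S = Any.here refl

  m∈S : m ∈ S
  m∈S = Any.there (Any.here refl)

  s∈S⇒s≤m : ∀ {s} → s ∈ S → s ≤ m
  s∈S⇒s≤m (Any.here refl)             = >-nonZero⁻¹ m
  s∈S⇒s≤m (Any.there (Any.here refl)) = ≤-refl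

  grid<mq : ∀ {a b} → a < q → b < m → b + a * m < m * q
  grid<mq {a} {b} a<q b<m = begin-strict
    b + a * m   <⟨ +-monoˡ-< (a * m) b<m ⟩
    m + a * m   ≤⟨ *-monoˡ-≤ m a<q ⟩
    q * m       ≡⟨ *-comm q m ⟩
    m * q       ∎
    where open ≤-Reasoning

  block : Fin (m * q) → ℕ
  block x = toℕ x / m

  block<q : ∀ x → block x < q
  block<q x = m<n*o⇒m/o<n (subst (toℕ x <_) (*-comm m q) (toℕ<n x))

  blockStart : Fin q → Fin (m * q)
  blockStart y = fromℕ< (grid<mq (toℕ<n y) (>-nonZero⁻¹ m))

  block∘blockStart : ∀ y → block (blockStart y) ≡ toℕ y
  block∘blockStart y = trans (cong (_/ m) (toℕ-fromℕ< _)) (m*n/n≡m (toℕ y) m)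

  forward-walk : ∀ {s} → s ∈ S → 1 ≤ s → ∀ t {u x y} → u + t * s < m * q →
                 toℕ x ≡ u → toℕ y ≡ u + t * s → Walk Adj x y t
  forward-walk s∈S 1≤s zero {u} _ ex ey =
    subst (λ y → Walk Adj _ y 0) (toℕ-injective (trans ex (trans (sym (+-identityʳ u)) (sym ey)))) here
  forward-walk {s} s∈S 1≤s (suc t) {u} {x} lt ex ey =
    step x~z (forward-walk s∈S 1≤s t lt' (toℕ-fromℕ< u+s<mq) (trans ey (sym (+-assoc u s (t * s)))))
    where
    u+s<mq : u + s < m * q
    u+s<mq = ≤-<-trans (+-monoʳ-≤ u (m≤m+n s (t * s))) lt
    lt' : u + s + t * s < m * q
    lt' = subst (_< m * q) (sym (+-assoc u s (t * s))) lt
    x~z : Adj x (fromℕ< u+s<mq)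
    x~z = x≢z , s , s∈S , inj₁ (trans (m<n⇒m%n≡m (subst (λ v → v + s < m * q) (sym ex) u+s<mq))
                                      (trans (cong (_+ s) ex) (sym (toℕ-fromℕ< u+s<mq))))
      where
      x≢z : ¬ x ≡ fromℕ< u+s<mq
      x≢z refl = <-irrefl (trans (toℕ-fromℕ< u+s<mq) (cong (_+ s) (sym ex))) (m<m+n (toℕ x) 1≤s)

  ordered-line-walk : ∀ {s} → s ∈ S → 1 ≤ s → ∀ o {t t' x y} → t ≤ t' → o + t' * s < m * q →
                      toℕ x ≡ o + t * s → toℕ y ≡ o + t' * s → Walk Adj x y (t' ∸ t)
  ordered-line-walk {s} s∈S 1≤s o {t} {t'} t≤t' lt' ex ey =
    forward-walk s∈S 1≤s (t' ∸ t) (subst (_< m * q) split lt') ex (trans ey split)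
    where
    split : o + t' * s ≡ o + t * s + (t' ∸ t) * s
    split = o+t'*s≡o+t*s+[t'∸t]*s o s t≤t'

  line-walk : ∀ {s} → s ∈ S → 1 ≤ s → ∀ o t t' {x y} → o + t * s < m * q → o + t' * s < m * q →
              toℕ x ≡ o + t * s → toℕ y ≡ o + t' * s → Walk Adj x y ∣ t - t' ∣
  line-walk s∈S 1≤s o t t' lt lt' ex ey with ≤-total t t'
  ... | inj₁ t≤t' = subst (Walk Adj _ _) (sym (m≤n⇒∣m-n∣≡n∸m t≤t'))
                      (ordered-line-walk s∈S 1≤s o t≤t' lt' ex ey)
  ... | inj₂ t'≤t = subst (Walk Adj _ _) (sym (m≤n⇒∣n-m∣≡n∸m t'≤t))
                      (reverseʷ CircAdj-sym (ordered-line-walk s∈S 1≤s o t'≤t lt ey ex))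

  grid-walk : ∀ {c a h b x y} → c < q → a < q → h < m → b < m →
              toℕ x ≡ h + c * m → toℕ y ≡ b + a * m → Walk Adj x y (∣ c - a ∣ + ∣ h - b ∣)
  grid-walk {c} {a} {h} {b} c<q a<q h<m b<m ex ey =
    line-walk m∈S (>-nonZero⁻¹ m) h c a {y = corner} (grid<mq c<q h<m) (grid<mq a<q h<m) ex (toℕ-fromℕ< _)
    ++ʷ line-walk 1∈S ≤-refl (a * m) h b (as-offset (grid<mq a<q h<m)) (as-offset (grid<mq a<q b<m))
          (trans (toℕ-fromℕ< _) (offset h)) (trans ey (offset b))
    where
    corner : Fin (m * q)
    corner = fromℕ< (grid<mq a<q h<m)
    offset : ∀ b → b + a * m ≡ a * m + b * 1
    offset b = trans (+-comm b (a * m)) (cong (a * m +_) (sym (*-identityʳ b)))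
    as-offset : ∀ {b} → b + a * m < m * q → a * m + b * 1 < m * q
    as-offset {b} = subst (_< m * q) (offset b)

  block-step : ∀ t {s} → s ≤ m → ∃[ d ] (d ≤ 1 × (t + s) / m ≡ t / m + d)
  block-step t {s} s≤m = (t + s) / m ∸ t / m , m≤n+o⇒m∸n≤o _ (t / m) at-most-one , sym (m+[n∸m]≡n at-least)
    where
    at-least : t / m ≤ (t + s) / m
    at-least = /-monoˡ-≤ m (m≤m+n t s)
    at-most-one : (t + s) / m ≤ t / m + 1
    at-most-one = begin
      (t + s) / m      ≤⟨ /-monoˡ-≤ m (+-monoʳ-≤ t s≤m) ⟩
      (t + m) / m      ≡⟨ +-distrib-/-∣ʳ t (∣-refl {m}) ⟩
      t / m + m / m    ≡⟨ cong (t / m +_) (n/n≡1 m) ⟩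
      t / m + 1        ∎
      where open ≤-Reasoning

  wrap⇒≋ : ∀ {w z} → w % (m * q) ≡ toℕ z → w / m ≋ block z
  wrap⇒≋ {w} {z} w↦z = 0 , w / (m * q) , (begin
      w / m + 0                                     ≡⟨ +-identityʳ (w / m) ⟩
      w / m                                         ≡⟨ cong (_/ m) (m≡m%n+[m/n]*n w (m * q)) ⟩
      (w % (m * q) + w / (m * q) * (m * q)) / m     ≡⟨ cong₂ (λ u v → (u + v) / m) w↦z (regroup (w / (m * q))) ⟩
      (toℕ z + w / (m * q) * q * m) / m             ≡⟨ +-distrib-/-∣ʳ (toℕ z) (n∣m*n (w / (m * q) * q)) ⟩
      block z + w / (m * q) * q * m / m             ≡⟨ cong (block z +_) (m*n/n≡m (w / (m * q) * q) m) ⟩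
      block z + w / (m * q) * q                     ∎)
    where
    open ≡-Reasoning
    regroup : ∀ k → k * (m * q) ≡ k * q * m
    regroup k = trans (cong (k *_) (*-comm m q)) (sym (*-assoc k q m))

  adj⇒near : ∀ {x z} → Adj x z → Near (block x) (block z)
  adj⇒near {x} {z} (_ , s , s∈S , inj₁ x+s↦z) with block-step (toℕ x) (s∈S⇒s≤m s∈S)
  ... | d , d≤1 , e = d , d≤1 , inj₁ (subst (_≋ block z) e (wrap⇒≋ x+s↦z))
  adj⇒near {x} {z} (_ , s , s∈S , inj₂ z+s↦x) with block-step (toℕ z) (s∈S⇒s≤m s∈S)
  ... | d , d≤1 , e = d , d≤1 , inj₂ (subst (_≋ block x) e (wrap⇒≋ z+s↦x))

  burningSeq⇒q≤k*k : ∀ k xs → IsBurningSeq Adj k xs → q ≤ k * k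
  burningSeq⇒q≤k*k = CycleLowerBound.burningSeq⇒q≤k*k Adj q block blockStart block∘blockStart adj⇒near

  module Sources (r : ℕ) where

    h : ℕ
    h = m / 2

    h<m : h < m
    h<m = m/n<m m 2 (s≤s (s≤s z≤n))

    U : ℕ
    U = r + h

    clamped<q : ∀ ℓ → pathCentre r ℓ ⊓ (q ∸ 1) < q
    clamped<q ℓ = m≤pred[n]⇒suc[m]≤n (m⊓n≤n (pathCentre r ℓ) (q ∸ 1))

    centre : ℕ → Fin (m * q)
    centre ℓ = fromℕ< (grid<mq (clamped<q ℓ) h<m)

    sources : Vec (Fin (m * q)) U
    sources = tabulate λ i → centre (U ∸ suc (toℕ i) ∸ h)

    sources-burn : q ≤ r * r → IsBurningSeq Adj U sources
    sources-burn q≤r*r y with path-cover (<-≤-trans (block<q y) q≤r*r)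
    ... | ℓ , ℓ<r , close = i , distance , subst (distance ≤_) (sym radius≡) length≤ ,
                            subst (λ x → Walk Adj x y distance) (sym source≡) walk
      where
      i : Fin U
      i = opposite (fromℕ< (+-monoˡ-< h ℓ<r))
      radius≡ : U ∸ suc (toℕ i) ≡ ℓ + h
      radius≡ = trans (sym (opposite-prop i))
                  (trans (cong toℕ (opposite-involutive _)) (toℕ-fromℕ< _))
      source≡ : lookup sources i ≡ centre ℓ
      source≡ = trans (lookup∘tabulate _ i) (cong centre (trans (cong (_∸ h) radius≡) (m+n∸n≡m ℓ h)))
      c : ℕ
      c = pathCentre r ℓ ⊓ (q ∸ 1)
      distance : ℕ
      distance = ∣ c - block y ∣ + ∣ h - toℕ y % m ∣
      walk : Walk Adj (centre ℓ) y distance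
      walk = grid-walk (clamped<q ℓ) (block<q y) h<m (m%n<n (toℕ y) m) (toℕ-fromℕ< _)
               (m≡m%n+[m/n]*n (toℕ y) m)
      length≤ : distance ≤ ℓ + h
      length≤ = +-mono-≤ (≤-trans (∣m⊓o-n∣≤∣m-n∣ {pathCentre r ℓ} (<⇒≤pred (block<q y))) close)
                         (∣m/2-b∣≤m/2 (m%n<n (toℕ y) m))

  burningNumber-between : ∀ {r} → IsCeilSqrt q r → ∃[ b ] (IsBurningNumber Adj b × r ≤ b × b ≤ r + m / 2)
  burningNumber-between {r} ceilSqrt@(_ , q≤r*r) =
    let b , burning , b≤r+h = burningNumber-exists (sources , sources-burn q≤r*r)
        (xs , burns) , _ = burning
    in b , burning , ceilSqrt-minimal ceilSqrt (burningSeq⇒q≤k*k b xs burns) , b≤r+h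
    where
    open Sources r
    open BurningDecidable (circAdj? (m * q) S)

mainTheorem9 : (q m r : ℕ) → 2 < q → 2 ≤ m → IsCeilSqrt q r →
    (nz : NonZero (m * q)) →
    ∃[ b ] (IsBurningNumber (CircAdj (m * q) {{nz}} (1 ∷ m ∷ [])) b
            × r ≤ b × b ≤ r + m / 2)
mainTheorem9 q m r 2<q 2≤m ceilSqrt nz =
  CirculantBlocks.burningNumber-between m q {{m≢0}} {{q≢0}} {{nz}} ceilSqrt
  where
  m≢0 : NonZero m
  m≢0 = >-nonZero (<-≤-trans (s≤s z≤n) 2≤m)
  q≢0 : NonZero q
  q≢0 = >-nonZero (<-trans (s≤s z≤n) 2<q)
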